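{- For all $n\in\omega$ and all $(\alpha_1,\dots,\alpha_n)\in(2^\omega)^n$ with $\alpha_1<_{lex}\alpha_2<_{lex}\dots<_{lex}\alpha_n$ we have \[ s_{(\alpha_1,\dots,\alpha_n)}\le_{sW}\bigsqcup_{i=1}^n s_{\alpha_i}\quad\text{and}\quad \bigsqcup_{i=1}^n s_{\alpha_i}\le_W s_{(\alpha_1,\dots,\alpha_n)}. \]
   Context: Cantor space $2^\omega$ carries the lexicographic order $<_{lex}$. For $\alpha\in2^\omega$, $s_\alpha\colon 2^\omega\to\{0,1\}$ is $s_\alpha(x)=0$ if $x<_{lex}\alpha$ and $1$ otherwise. For $\alpha_1<_{lex}\dots<_{lex}\alpha_n$, $s_{(\alpha_1,\dots,\alpha_n)}\colon2^\omega\to\{0,\dots,n\}$ maps $x$ to $0$ if $x<_{lex}\alpha_1$, to $j$ if $\alpha_j\le_{lex}x<_{lex}\alpha_{j+1}$ ($1\le j<n$), and to $n$ if $\alpha_n\le_{lex}x$. The coproduct $\bigsqcup_{i=1}^n s_{\alpha_i}$ takes as input a pair $(k,x)$ with $1\le k\le n$ and $x\in2^\omega$ and outputs $(k,s_{\alpha_k}(x))$. $f\le_W g$ means there are computable functionals $\Phi,\Psi$ with $f(x)=\Psi(x,g(\Phi(x)))$ for all $x$; $f\le_{sW}g$ means $f(x)=\Psi(g(\Phi(x)))$. -}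

module Defs where

open import Data.Nat using (ℕ; zero; suc; _≤_; _<_)
open import Data.Bool using (Bool; true; false)
open import Data.Fin using (Fin; toℕ)
open import Data.Vec using (Vec; []; _∷_; lookup)
open import Data.Product using (Σ; _×_)
open import Data.Sum using (_⊎_)
open import Relation.Binary.PropositionalEquality using (_≡_)

Cantor : Set
Cantor = ℕ → Bool

_<lex_ : Cantor → Cantor → Set
x <lex y = Σ ℕ λ m → (∀ i → i < m → x i ≡ y i) × (x m ≡ false) × (y m ≡ true)

_≤lex_ : Cantor → Cantor → Set
x ≤lex y = (∀ i → x i ≡ y i) ⊎ (x <lex y)

-- s_α(x) = j  (as a relation; s_α is not computable / not definable constructively)
SAlphaVal : Cantor → Cantor → ℕ → Set
SAlphaVal α x j = (j ≡ 0 × x <lex α) ⊎ (j ≡ 1 × α ≤lex x)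

-- s_(α_1,...,α_n)(x) = j ; α (i) stands for α_{i+1}
SVecVal : ∀ {n} → (Fin n → Cantor) → Cantor → ℕ → Set
SVecVal {n} α x j =
  (j ≤ n) ×
  ((∀ (i : Fin n) → toℕ i < j → α i ≤lex x) ×
   (∀ (i : Fin n) → j ≤ toℕ i → x <lex α i))

Baire : Set
Baire = ℕ → ℕ

bit : ℕ → Bool
bit zero = false
bit (suc _) = true

-- Cantor space is represented by the {0,1}-valued elements of Baire space
CantorName : Baire → Set
CantorName p = ∀ i → p i ≤ 1

asCantor : Baire → Cantor
asCantor p i = bit (p i)

tail : Baire → Baire
tail p i = p (suc i)

-- pairing ⟨p,q⟩(2i) = p i, ⟨p,q⟩(2i+1) = q i
pair : Baire → Baire → Baire
pair p q zero = p 0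
pair p q (suc zero) = q 0
pair p q (suc (suc k)) = pair (λ i → p (suc i)) (λ i → q (suc i)) k

-- Oracle μ-recursive functions (Kleene's model of relative computability)

data Code : ℕ → Set where
  zer  : ∀ {k} → Code k
  succ : Code 1
  proj : ∀ {k} → Fin k → Code k
  orc  : Code 1
  comp : ∀ {m k} → Code m → Vec (Code k) m → Code k
  prec : ∀ {k} → Code k → Code (suc (suc k)) → Code (suc k)
  mu   : ∀ {k} → Code (suc k) → Code k

mutual
  data Eval (p : Baire) : ∀ {k} → Code k → Vec ℕ k → ℕ → Set where
    ev-zer  : ∀ {k} {xs : Vec ℕ k} → Eval p zer xs 0
    ev-succ : ∀ {x} → Eval p succ (x ∷ []) (suc x)
    ev-proj : ∀ {k} {i : Fin k} {xs} → Eval p (proj i) xs (lookup xs i)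
    ev-orc  : ∀ {x} → Eval p orc (x ∷ []) (p x)
    ev-comp : ∀ {m k} {f : Code m} {gs : Vec (Code k) m} {xs ys v} →
              EvalAll p gs xs ys → Eval p f ys v → Eval p (comp f gs) xs v
    ev-prec0 : ∀ {k} {f : Code k} {g} {xs v} →
               Eval p f xs v → Eval p (prec f g) (0 ∷ xs) v
    ev-precS : ∀ {k} {f : Code k} {g} {y xs w v} →
               Eval p (prec f g) (y ∷ xs) w → Eval p g (y ∷ w ∷ xs) v →
               Eval p (prec f g) (suc y ∷ xs) v
    ev-mu   : ∀ {k} {f : Code (suc k)} {xs z} →
              Eval p f (z ∷ xs) 0 →
              (∀ y → y < z → Σ ℕ λ w → Eval p f (y ∷ xs) (suc w)) →
              Eval p (mu f) xs z

  data EvalAll (p : Baire) {k : ℕ} : ∀ {m} → Vec (Code k) m → Vec ℕ k → Vec ℕ m → Set where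
    []  : ∀ {xs} → EvalAll p [] xs []
    _∷_ : ∀ {m} {g} {gs : Vec (Code k) m} {xs y ys} →
          Eval p g xs y → EvalAll p gs xs ys → EvalAll p (g ∷ gs) xs (y ∷ ys)

Computes : Code 1 → Baire → Baire → Set
Computes e p r = ∀ m → Eval p e (m ∷ []) (r m)

record Problem : Set₁ where
  field
    Dom : Baire → Set
    Sol : Baire → Baire → Set  -- Sol p q : q is a name of a correct output for instance p

open Problem

_≤W_ : Problem → Problem → Set
f ≤W g = Σ (Code 1) λ Φ → Σ (Code 1) λ Ψ →
  ∀ p → Dom f p → Σ Baire λ r → Computes Φ p r × Dom g r ×
    (∀ q → Sol g r q → Σ Baire λ t → Computes Ψ (pair p q) t × Sol f p t)

_≤sW_ : Problem → Problem → Set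
f ≤sW g = Σ (Code 1) λ Φ → Σ (Code 1) λ Ψ →
  ∀ p → Dom f p → Σ Baire λ r → Computes Φ p r × Dom g r ×
    (∀ q → Sol g r q → Σ Baire λ t → Computes Ψ q t × Sol f p t)

-- The concrete problems.  A natural number j in {0,...,n} is named by any q with q 0 = j.

sVec : ∀ {n} → (Fin n → Cantor) → Problem
Dom (sVec α) p = CantorName p
Sol (sVec α) p q = SVecVal α (asCantor p) (q 0)

-- ⊔_{i=1}^n s_{α_i}: an instance (k,x), 1 ≤ k ≤ n, is named by p with p 0 = k, tail p a name of x;
-- an output (k,b) is named by q with q 0 = k and q 1 = b.
coprodS : ∀ {n} → (Fin n → Cantor) → Problem
Dom (coprodS {n} α) p = (Σ (Fin n) λ i → p 0 ≡ suc (toℕ i)) × CantorName (tail p)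
Sol (coprodS {n} α) p q = ∀ (i : Fin n) → p 0 ≡ suc (toℕ i) →
  (q 0 ≡ p 0) × SAlphaVal (α i) (asCantor (tail p)) (q 1)

{-# OPTIONS --safe #-}
module Submission where

-- If αᵢ and αᵢ₊₁ first differ at position mᵢ, then the first mᵢ + 1 bits of x
-- already decide whether αᵢ <lex x or x <lex αᵢ₊₁.  Running these tests from left
-- to right, a finite prefix of x yields an index i with αⱼ <lex x for j < i and
-- x <lex αⱼ for j > i, so that s_(α)(x) = i + s_αᵢ(x) (indices from 0): asking the
-- coproduct about (i + 1, x) gives the answer.  Conversely s_αₖ(x) = 1 exactly when
-- k ≤ s_(α)(x), which is computable from k and s_(α)(x).

open import Defs
open import Data.Nat using (ℕ; zero; suc; _+_; _∸_; pred; _≤_; _<_; _<?_; z≤n; s≤s)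
open import Data.Nat.Properties
  using (+-identityʳ; +-comm; +-suc; m≤m+n; m≤n+m; ≤-trans; <-trans; <-cmp; ≤-refl; m<n⇒m<1+n; <⇒≤;
         ≮⇒≥; m≤n⇒m<n∨m≡n; m≤n⇒m∸n≡0; m<n⇒0<n∸m; pred[m∸n]≡m∸[1+n])
open import Data.Fin using (Fin; toℕ; zero; suc) renaming (_<_ to _<ᶠ_)
open import Data.Fin.Properties using (toℕ<n; toℕ-injective)
open import Data.Bool using (Bool; true; false; if_then_else_; _xor_)
open import Data.List using (List; []; _∷_)
open import Data.Vec using (Vec; []; _∷_)
open import Data.Product using (_×_; _,_; proj₁; proj₂)
open import Data.Sum using (_⊎_; inj₁; inj₂)
import Data.Sum as Sum
open import Function using (_∘_)
open import Relation.Nullary using (yes; no)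
open import Relation.Binary using (tri<; tri≈; tri>)
open import Relation.Binary.PropositionalEquality using (_≡_; refl; sym; trans; cong; cong₂; subst)

constant : ∀ {k} → ℕ → Code k
constant zero    = zer
constant (suc c) = comp succ (constant c ∷ [])

query : ∀ {k} → ℕ → Code k
query c = comp orc (constant c ∷ [])

predecessor : Code 1
predecessor = prec zer (proj zero)

plus : Code 2
plus = prec (proj zero) (comp succ (proj (suc zero) ∷ []))

monus : Code 2
monus = prec (proj zero) (comp predecessor (proj (suc zero) ∷ []))

branch : Code 0 → Code 0 → Code 1
branch a b = prec a (comp b [])

sg : ℕ → ℕ
sg n = if bit n then 1 else 0

sign : Code 1
sign = branch (constant 0) (constant 1)

module _ (p : Baire) where

  eval-constant : ∀ {k} {xs : Vec ℕ k} c → Eval p (constant c) xs c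
  eval-constant zero    = ev-zer
  eval-constant (suc c) = ev-comp (eval-constant c ∷ []) ev-succ

  eval-query : ∀ {k} {xs : Vec ℕ k} c → Eval p (query c) xs (p c)
  eval-query c = ev-comp (eval-constant c ∷ []) ev-orc

  eval-predecessor : ∀ m → Eval p predecessor (m ∷ []) (pred m)
  eval-predecessor zero    = ev-prec0 ev-zer
  eval-predecessor (suc m) = ev-precS (eval-predecessor m) ev-proj

  eval-plus : ∀ m n → Eval p plus (m ∷ n ∷ []) (m + n)
  eval-plus zero    n = ev-prec0 ev-proj
  eval-plus (suc m) n = ev-precS (eval-plus m n) (ev-comp (ev-proj ∷ []) ev-succ)

  eval-monus : ∀ n m → Eval p monus (n ∷ m ∷ []) (m ∸ n)
  eval-monus zero    m = ev-prec0 ev-proj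
  eval-monus (suc n) m = subst (Eval p monus (suc n ∷ m ∷ [])) (pred[m∸n]≡m∸[1+n] m n)
    (ev-precS (eval-monus n m) (ev-comp (ev-proj ∷ []) (eval-predecessor (m ∸ n))))

  eval-branch : ∀ {a b} (g : Bool → ℕ) → Eval p a [] (g false) → Eval p b [] (g true) →
                ∀ m → Eval p (branch a b) (m ∷ []) (g (bit m))
  eval-branch g ea eb zero    = ev-prec0 ea
  eval-branch g ea eb (suc m) = ev-precS (eval-branch g ea eb m) (ev-comp [] eb)

  eval-sign : ∀ m → Eval p sign (m ∷ []) (sg m)
  eval-sign = eval-branch (λ b → if b then 1 else 0) (eval-constant 0) (eval-constant 1)

window : ℕ → ℕ → Cantor → List Bool
window o zero    x = []
window o (suc d) x = x o ∷ window (suc o) d x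

padFalse : List Bool → Cantor
padFalse []      i       = false
padFalse (b ∷ l) zero    = b
padFalse (b ∷ l) (suc i) = padFalse l i

decisionTree : ℕ → ℕ → (List Bool → ℕ) → Code 0
decisionTree o zero    f = constant (f [])
decisionTree o (suc d) f =
  comp (branch (decisionTree (suc o) d (f ∘ (false ∷_))) (decisionTree (suc o) d (f ∘ (true ∷_))))
       (query o ∷ [])

eval-decisionTree : ∀ p o d f → Eval p (decisionTree o d f) [] (f (window o d (asCantor p)))
eval-decisionTree p o zero    f = eval-constant p (f [])
eval-decisionTree p o (suc d) f =
  ev-comp (eval-query p o ∷ [])
    (eval-branch p (λ b → f (b ∷ window (suc o) d (asCantor p)))
       (eval-decisionTree p (suc o) d (f ∘ (false ∷_)))
       (eval-decisionTree p (suc o) d (f ∘ (true ∷_)))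
       (p o))

AgreeBelow : ℕ → Cantor → Cantor → Set
AgreeBelow m x y = ∀ i → i < m → x i ≡ y i

agreeBelow-≤ : ∀ {m n x y} → m ≤ n → AgreeBelow n x y → AgreeBelow m x y
agreeBelow-≤ m≤n agree i i<m = agree i (≤-trans i<m m≤n)

padFalse-window : ∀ o d x i → i < d → padFalse (window o d x) i ≡ x (i + o)
padFalse-window o (suc d) x zero    _         = refl
padFalse-window o (suc d) x (suc i) (s≤s i<d) =
  trans (padFalse-window (suc o) d x i i<d) (cong x (+-suc i o))

DependsOnlyOnFirst : ℕ → (Cantor → ℕ) → Set
DependsOnlyOnFirst d F = ∀ x y → AgreeBelow d x y → F x ≡ F y

eval-dependsOnlyOnFirst : ∀ {d F} → DependsOnlyOnFirst d F →
  ∀ p → Eval p (decisionTree 0 d (F ∘ padFalse)) [] (F (asCantor p))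
eval-dependsOnlyOnFirst {d} {F} local p =
  subst (Eval p (decisionTree 0 d (F ∘ padFalse)) [])
    (local _ _ λ i i<d → trans (padFalse-window 0 d x i i<d) (cong x (+-identityʳ i)))
    (eval-decisionTree p 0 d (F ∘ padFalse))
  where x = asCantor p

<lex-trans : ∀ {x y z} → x <lex y → y <lex z → x <lex z
<lex-trans {x} {y} {z} (m , x≈y , x₀ , y₁) (n , y≈z , y₀ , z₁) with <-cmp m n
... | tri< m<n _ _ = m , (λ i i<m → trans (x≈y i i<m) (y≈z i (<-trans i<m m<n))) , x₀ ,
                     trans (sym (y≈z m m<n)) y₁
... | tri≈ _ refl _ with () ← trans (sym y₁) y₀
... | tri> _ _ n<m = n , (λ i i<n → trans (x≈y i (<-trans i<n n<m)) (y≈z i i<n)) ,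
                     trans (x≈y n n<m) y₀ , z₁

shift : Cantor → Cantor
shift x i = x (suc i)

<lex-cons : ∀ {x y} → x 0 ≡ y 0 → shift x <lex shift y → x <lex y
<lex-cons x₀≡y₀ (m , agree , x₀ , y₁) =
  suc m , (λ { zero _ → x₀≡y₀ ; (suc i) (s≤s i<m) → agree i i<m }) , x₀ , y₁

agreeBelow-cons : ∀ {m x y} → x 0 ≡ y 0 → AgreeBelow m (shift x) (shift y) → AgreeBelow (suc m) x y
agreeBelow-cons x₀≡y₀ agree zero    _         = x₀≡y₀
agreeBelow-cons x₀≡y₀ agree (suc i) (s≤s i<m) = agree i i<m

prefix≥ᵇ : ℕ → Cantor → Cantor → Bool
prefix≥ᵇ zero    x y = true
prefix≥ᵇ (suc m) x y = if x 0 xor y 0 then x 0 else prefix≥ᵇ m (shift x) (shift y)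

prefix≥ᵇ-false : ∀ m x y → prefix≥ᵇ m x y ≡ false → x <lex y
prefix≥ᵇ-false zero    x y ()
prefix≥ᵇ-false (suc m) x y ≥ᵇ with x 0 in x₀ | y 0 in y₀
prefix≥ᵇ-false (suc m) x y () | true  | false
... | false | true  = 0 , (λ _ ()) , x₀ , y₀
... | false | false = <lex-cons (trans x₀ (sym y₀)) (prefix≥ᵇ-false m (shift x) (shift y) ≥ᵇ)
... | true  | true  = <lex-cons (trans x₀ (sym y₀)) (prefix≥ᵇ-false m (shift x) (shift y) ≥ᵇ)

prefix≥ᵇ-true : ∀ m x y → prefix≥ᵇ m x y ≡ true → AgreeBelow m x y ⊎ y <lex x
prefix≥ᵇ-true zero    x y _ = inj₁ (λ _ ())
prefix≥ᵇ-true (suc m) x y ≥ᵇ with x 0 in x₀ | y 0 in y₀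
prefix≥ᵇ-true (suc m) x y () | false | true
... | true  | false = inj₂ (0 , (λ _ ()) , y₀ , x₀)
... | false | false = Sum.map (agreeBelow-cons (trans x₀ (sym y₀))) (<lex-cons (trans y₀ (sym x₀)))
                        (prefix≥ᵇ-true m (shift x) (shift y) ≥ᵇ)
... | true  | true  = Sum.map (agreeBelow-cons (trans x₀ (sym y₀))) (<lex-cons (trans y₀ (sym x₀)))
                        (prefix≥ᵇ-true m (shift x) (shift y) ≥ᵇ)

prefix≥ᵇ-cong : ∀ m {x x′} y → AgreeBelow m x x′ → prefix≥ᵇ m x y ≡ prefix≥ᵇ m x′ y
prefix≥ᵇ-cong zero    y agree = refl
prefix≥ᵇ-cong (suc m) y agree
  rewrite agree 0 (s≤s z≤n) | prefix≥ᵇ-cong m (shift y) (λ i i<m → agree (suc i) (s≤s i<m)) = refl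

prefix≥ᵇ-split : ∀ {x y z} (x<y : x <lex y) → prefix≥ᵇ (suc (proj₁ x<y)) z y ≡ true → x <lex z
prefix≥ᵇ-split {x} {y} {z} x<y@(m , x≈y , x₀ , y₁) ≥ᵇ with prefix≥ᵇ-true (suc m) z y ≥ᵇ
... | inj₁ z≈y = m , (λ i i<m → trans (x≈y i i<m) (sym (z≈y i (m<n⇒m<1+n i<m)))) , x₀ ,
                 trans (z≈y m ≤-refl) y₁
... | inj₂ y<z = <lex-trans x<y y<z

LexIncreasing : ∀ {n} → (Fin n → Cantor) → Set
LexIncreasing α = ∀ i j → i <ᶠ j → α i <lex α j

lexIncreasing-tail : ∀ {n} {α : Fin (suc n) → Cantor} → LexIncreasing α → LexIncreasing (α ∘ suc)
lexIncreasing-tail α↑ i j i<j = α↑ (suc i) (suc j) (s≤s i<j)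

Bracketed : ∀ {n} → (Fin n → Cantor) → Fin n → Cantor → Set
Bracketed α i x = (∀ j → j <ᶠ i → α j <lex x) × (∀ j → i <ᶠ j → x <lex α j)

firstGap : ∀ {n} {α : Fin (suc (suc n)) → Cantor} → LexIncreasing α → α zero <lex α (suc zero)
firstGap α↑ = α↑ zero (suc zero) (s≤s z≤n)

pastFirstGapᵇ : ∀ {n} (α : Fin (suc (suc n)) → Cantor) → LexIncreasing α → Cantor → Bool
pastFirstGapᵇ α α↑ x = prefix≥ᵇ (suc (proj₁ (firstGap α↑))) x (α (suc zero))

locate : ∀ {n} (α : Fin (suc n) → Cantor) → LexIncreasing α → Cantor → Fin (suc n)
locate {zero}  α α↑ x = zero
locate {suc n} α α↑ x =
  if pastFirstGapᵇ α α↑ x then suc (locate (α ∘ suc) (lexIncreasing-tail α↑) x) else zero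

locateDepth : ∀ {n} (α : Fin (suc n) → Cantor) → LexIncreasing α → ℕ
locateDepth {zero}  α α↑ = 0
locateDepth {suc n} α α↑ = suc (proj₁ (firstGap α↑)) + locateDepth (α ∘ suc) (lexIncreasing-tail α↑)

locate-cong : ∀ {n} (α : Fin (suc n) → Cantor) (α↑ : LexIncreasing α) {x y} →
              AgreeBelow (locateDepth α α↑) x y → locate α α↑ x ≡ locate α α↑ y
locate-cong {zero}  α α↑ agree = refl
locate-cong {suc n} α α↑ agree =
  cong₂ (λ b i → if b then suc i else zero)
    (prefix≥ᵇ-cong (suc (proj₁ (firstGap α↑))) (α (suc zero)) (agreeBelow-≤ (m≤m+n _ _) agree))
    (locate-cong (α ∘ suc) (lexIncreasing-tail α↑) (agreeBelow-≤ (m≤n+m _ _) agree))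

locate-bracketed : ∀ {n} (α : Fin (suc n) → Cantor) (α↑ : LexIncreasing α) x →
                   Bracketed α (locate α α↑ x) x
locate-bracketed {zero}  α α↑ x = (λ _ ()) , λ { zero () }
locate-bracketed {suc n} α α↑ x with pastFirstGapᵇ α α↑ x in past
... | true = below , above
  where
  i = locate (α ∘ suc) (lexIncreasing-tail α↑) x
  bracketed = locate-bracketed (α ∘ suc) (lexIncreasing-tail α↑) x
  below : ∀ j → j <ᶠ suc i → α j <lex x
  below zero    _         = prefix≥ᵇ-split (firstGap α↑) past
  below (suc j) (s≤s j<i) = proj₁ bracketed j j<i
  above : ∀ j → suc i <ᶠ j → x <lex α j
  above (suc j) (s≤s i<j) = proj₂ bracketed j i<j
... | false = (λ _ ()) , λ { (suc j) _ → below-suc j }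
  where
  x<α₁ = prefix≥ᵇ-false (suc (proj₁ (firstGap α↑))) x (α (suc zero)) past
  below-suc : ∀ j → x <lex α (suc j)
  below-suc zero    = x<α₁
  below-suc (suc j) = <lex-trans x<α₁ (α↑ (suc zero) (suc (suc j)) (s≤s (s≤s z≤n)))

bracketed⇒sVecVal : ∀ {n} (α : Fin n → Cantor) {i x b} → Bracketed α i x →
                    SAlphaVal (α i) x b → SVecVal α x (toℕ i + b)
bracketed⇒sVecVal α {i} (below , above) (inj₁ (refl , x<αᵢ)) rewrite +-identityʳ (toℕ i) =
  <⇒≤ (toℕ<n i) , (λ j j<i → inj₂ (below j j<i)) , above-or-at
  where
  above-or-at : ∀ j → toℕ i ≤ toℕ j → _ <lex α j
  above-or-at j i≤j with m≤n⇒m<n∨m≡n i≤j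
  ... | inj₁ i<j = above j i<j
  ... | inj₂ i≡j rewrite toℕ-injective i≡j = x<αᵢ
bracketed⇒sVecVal α {i} (below , above) (inj₂ (refl , αᵢ≤x)) rewrite +-comm (toℕ i) 1 =
  toℕ<n i , below-or-at , above
  where
  below-or-at : ∀ j → toℕ j < suc (toℕ i) → α j ≤lex _
  below-or-at j (s≤s j≤i) with m≤n⇒m<n∨m≡n j≤i
  ... | inj₁ j<i = inj₂ (below j j<i)
  ... | inj₂ j≡i rewrite toℕ-injective j≡i = αᵢ≤x

sg-pos : ∀ {n} → 0 < n → sg n ≡ 1
sg-pos (s≤s _) = refl

sVecVal⇒sAlphaVal : ∀ {n} (α : Fin n → Cantor) {x j} → SVecVal α x j →
                    ∀ i → SAlphaVal (α i) x (sg (j ∸ toℕ i))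
sVecVal⇒sAlphaVal α {j = j} (_ , below , above) i with toℕ i <? j
... | yes i<j = inj₂ (sg-pos (m<n⇒0<n∸m i<j) , below i i<j)
... | no  i≮j = inj₁ (cong sg (m≤n⇒m∸n≡0 (≮⇒≥ i≮j)) , above i (≮⇒≥ i≮j))

cons : ℕ → Baire → Baire
cons v p zero    = v
cons v p (suc m) = p m

prepend : Code 0 → Code 1
prepend c = prec c (comp orc (proj zero ∷ []))

computes-prepend : ∀ {c v} p → Eval p c [] v → Computes (prepend c) p (cons v p)
computes-prepend p ev zero    = ev-prec0 ev
computes-prepend p ev (suc m) = ev-precS (computes-prepend p ev m) (ev-comp (ev-proj ∷ []) ev-orc)

sVec≤sWcoprodS : ∀ {n} (α : Fin (suc n) → Cantor) → LexIncreasing α → sVec α ≤sW coprodS α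
sVec≤sWcoprodS α α↑ = prepend (decisionTree 0 (locateDepth α α↑) (slot ∘ padFalse)) , decode ,
  λ p name → cons (slot (asCantor p)) p ,
             computes-prepend p (eval-dependsOnlyOnFirst slot-local p) ,
             ((locate α α↑ (asCantor p) , refl) , name) ,
             λ q sol → (λ _ → pred (q 0) + q 1) , (λ _ → eval-decode q) , decode-correct p q sol
  where
  slot : Cantor → ℕ
  slot x = suc (toℕ (locate α α↑ x))

  slot-local : DependsOnlyOnFirst (locateDepth α α↑) slot
  slot-local x y agree = cong (suc ∘ toℕ) (locate-cong α α↑ agree)

  decode : Code 1
  decode = comp plus (comp predecessor (query 0 ∷ []) ∷ query 1 ∷ [])

  eval-decode : ∀ {m} q → Eval q decode (m ∷ []) (pred (q 0) + q 1)
  eval-decode q =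
    ev-comp (ev-comp (eval-query q 0 ∷ []) (eval-predecessor q (q 0)) ∷ eval-query q 1 ∷ [])
            (eval-plus q (pred (q 0)) (q 1))

  decode-correct : ∀ p q → Problem.Sol (coprodS α) (cons (slot (asCantor p)) p) q →
                   SVecVal α (asCantor p) (pred (q 0) + q 1)
  decode-correct p q sol with sol (locate α α↑ (asCantor p)) refl
  ... | q₀≡k , sα rewrite q₀≡k = bracketed⇒sVecVal α (locate-bracketed α α↑ (asCantor p)) sα

coprodS≤WsVec : ∀ {n} (α : Fin n → Cantor) → coprodS α ≤W sVec α
coprodS≤WsVec α = dropFirst , indexAndTest ,
  λ p (_ , name) → tail p , computes-dropFirst p , name ,
  λ q sv → cons (p 0) (λ _ → sg (suc (q 0) ∸ p 0)) , computes-indexAndTest (pair p q) ,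
           λ i k≡ → refl , subst (λ k → SAlphaVal (α i) (asCantor (tail p)) (sg (suc (q 0) ∸ k)))
                                 (sym k≡) (sVecVal⇒sAlphaVal α sv i)
  where
  dropFirst : Code 1
  dropFirst = comp orc (comp succ (proj zero ∷ []) ∷ [])

  computes-dropFirst : ∀ p → Computes dropFirst p (tail p)
  computes-dropFirst p m = ev-comp (ev-comp (ev-proj ∷ []) ev-succ ∷ []) ev-orc

  -- Run on ⟨p, q⟩, whose positions 0 and 1 hold k = p 0 and s_(α)(x) = q 0.
  indexAndTest : Code 1
  indexAndTest = prec (query 0) (comp sign (comp monus (query 0 ∷ comp succ (query 1 ∷ []) ∷ []) ∷ []))

  computes-indexAndTest : ∀ o → Computes indexAndTest o (cons (o 0) (λ _ → sg (suc (o 1) ∸ o 0)))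
  computes-indexAndTest o zero    = ev-prec0 (eval-query o 0)
  computes-indexAndTest o (suc m) = ev-precS (computes-indexAndTest o m)
    (ev-comp (ev-comp (eval-query o 0 ∷ ev-comp (eval-query o 1 ∷ []) ev-succ ∷ [])
                      (eval-monus o (o 0) (suc (o 1))) ∷ [])
             (eval-sign o _))

mainTheorem7 : (n : ℕ) → 1 ≤ n → (α : Fin n → Cantor) →
    (∀ (i j : Fin n) → i <ᶠ j → α i <lex α j) →
    (sVec α ≤sW coprodS α) × (coprodS α ≤W sVec α)
mainTheorem7 (suc n) _ α α↑ = sVec≤sWcoprodS α α↑ , coprodS≤WsVec α
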